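{- Let the array $\Omega=\{w(i,j)\}$, $i,j\in\mathbb{Z}^{+}$, be covered by rectangles of lengths $l_{m}$ and heights $h_{m}$ ($l_{m},h_{m}\in\mathbb{Z}^{+}$): the corner cell $w(1,1)$ is covered by the rectangle $l_{1}\times h_{1}$, the rectangle $l_{2}\times h_{1}$ adjoins it to the right, the rectangle $l_{1}\times h_{2}$ adjoins it below, and so on; rectangles with length $l_{s}$ form a column, rectangles with height $h_{r}$ form a row. The rectangles are traversed in Cantor diagonal order. For a cell $w(i,j)$ let $R=\max\{r:\sum_{m=1}^{r}h_{m}<i\}$ and $S=\max\{s:\sum_{m=1}^{s}l_{m}<j\}$ ($R,S\in\mathbb{Z}^{*}$, empty sums being $0$), so the rectangle containing $w(i,j)$ has length $l_{S+1}$ and height $h_{R+1}$. Put $t=\dfrac{(R+S)^{2}+3R+S}{2}$ (the Cantor number of that rectangle). Then the formula $$n= \sum_{r=1}^{R+S}h_{r}\Bigl(\sum_{s=1}^{R+S+1-r}l_{s}\Bigr) + \sum_{r=1}^{R}h_{r}l_{R+S+2-r} + \frac{(-1)^{t}+1}{2} \Bigl(l_{S+1}\bigl(i- \sum_{r=1}^{R}h_{r} -1\bigr)+j-\sum_{s=1}^{S}l_{s} \Bigr) - \frac{(-1)^{t}-1}{2} \Bigl(h_{R+1}\bigl(j- \sum_{s=1}^{S}l_{s} -1\bigr)+i-\sum_{r=1}^{R}h_{r} \Bigr)$$ gives the numeration of $\Omega$ in which the cells inside each rectangle are numbered row by row or column by column depending on the parity of $t$ (row by row for even $t$, column by column for odd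 $t$). If instead one sets $t=R+S$, the same formula gives the numeration within the rectangles row by row or column by column depending on the parity of the number of the diagonal formed by the rectangles $l_{s}\times h_{r}$ containing the current rectangle.
   Context: Generalization of Cantor diagonalization: the array $\Omega$ is covered by rectangles of variable lengths $l_m$ and heights $h_m$ instead of $1\times 1$ cells, and $n$ denotes the position of $w(i,j)$ in the resulting enumeration. -}

module Defs where

open import Data.Nat as ℕ using (ℕ; zero; suc; _+_; _*_; _∸_; _≤_; _<_; _<ᵇ_; _%_)
open import Data.Bool using (Bool; true; false; if_then_else_)
open import Data.Integer as ℤ using (ℤ; +_)
open import Data.Product using (_×_; ∃; ∃-syntax; _,_)
open import Data.Sum using (_⊎_)
open import Relation.Binary.PropositionalEquality using (_≡_)

-- Σ1 f r = Σ_{m=1}^{r} f m   (empty sum = 0). Sequences are 1-indexed: f 0 is unused.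
Σ1 : (ℕ → ℕ) → ℕ → ℕ
Σ1 f zero    = 0
Σ1 f (suc r) = Σ1 f r + f (suc r)

-- greatest r with r ≤ b and P r  (0 if there is none)
greatest : (ℕ → Bool) → ℕ → ℕ
greatest P zero    = 0
greatest P (suc b) = if P (suc b) then suc b else greatest P b

-- blockIdx h i = max { r : Σ_{m=1}^{r} h m < i }.
-- Since all h m ≥ 1, Σ_{m=1}^{r} h m ≥ r, so every such r is < i; hence
-- searching r ≤ i gives exactly the maximum (for i ≥ 1; r = 0 always qualifies).
blockIdx : (ℕ → ℕ) → ℕ → ℕ
blockIdx h i = greatest (λ r → Σ1 h r <ᵇ i) i

cantorT : ℕ → ℕ → ℕ
cantorT R S = ((R + S) ℕ.^ 2 + 3 * R + S) ℕ./ 2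

diagT : ℕ → ℕ → ℕ
diagT R S = R + S

formula : (τ : ℕ → ℕ → ℕ) (h l : ℕ → ℕ) → ℕ → ℕ → ℤ
formula τ h l i j =
      + Σ1 (λ r → h r * Σ1 l (suc (R + S) ∸ r)) (R + S)
  ℤ.+ + Σ1 (λ r → h r * l (R + S + 2 ∸ r)) R
  ℤ.+ ((sg ℤ.+ ℤ.1ℤ) ℤ./ + 2)
        ℤ.* (+ l (suc S) ℤ.* (+ i ℤ.- + Σ1 h R ℤ.- ℤ.1ℤ) ℤ.+ + j ℤ.- + Σ1 l S)
  ℤ.- ((sg ℤ.- ℤ.1ℤ) ℤ./ + 2)
        ℤ.* (+ h (suc R) ℤ.* (+ j ℤ.- + Σ1 l S ℤ.- ℤ.1ℤ) ℤ.+ + i ℤ.- + Σ1 h R)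
  where
    R = blockIdx h i
    S = blockIdx l j
    sg = ℤ.-1ℤ ℤ.^ τ R S

Lex : ℕ → ℕ → ℕ → ℕ → Set
Lex a b a' b' = a < a' ⊎ (a ≡ a' × b < b')

-- The traversal order on cells (i , j) (i = row index, j = column index):
-- rectangles (row-block R, column-block S, 0-indexed) in Cantor diagonal order,
-- i.e. by diagonal R + S, and within a diagonal by increasing R (this is the order
-- of the Cantor number ((R+S)^2+3R+S)/2); inside a rectangle the cells are ordered
-- row by row if τ R S is even and column by column if τ R S is odd.
Before : (τ : ℕ → ℕ → ℕ) (h l : ℕ → ℕ) → (ℕ × ℕ) → (ℕ × ℕ) → Set
Before τ h l (i , j) (i' , j') =
  Lex (R + S) R (R' + S') R'
  ⊎ (R ≡ R' × S ≡ S' ×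
      ((τ R S % 2 ≡ 0 → Lex i j i' j') × (τ R S % 2 ≡ 1 → Lex j i j' i')))
  where
    R  = blockIdx h i
    S  = blockIdx l j
    R' = blockIdx h i'
    S' = blockIdx l j'

-- N is "the numeration" of the cells (i , j), i , j ≥ 1, along the order _≺_:
-- N maps cells into the positive integers, onto them, and strictly increasingly
-- along _≺_ (as _≺_ is total, this determines N uniquely: N c = position of c).
IsNumeration : ((ℕ × ℕ) → (ℕ × ℕ) → Set) → (ℕ → ℕ → ℤ) → Set
IsNumeration _≺_ N =
  (∀ i j → 1 ≤ i → 1 ≤ j → ℤ.1ℤ ℤ.≤ N i j)
  × (∀ n → 1 ≤ n → ∃[ i ] ∃[ j ] (1 ≤ i × 1 ≤ j × N i j ≡ + n))
  × (∀ i j i' j' → 1 ≤ i → 1 ≤ j → 1 ≤ i' → 1 ≤ j' →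
       (i , j) ≺ (i' , j') → N i j ℤ.< N i' j')

-- Write i = 1 + (h₁ + … + h_R) + i' and j = 1 + (l₁ + … + l_S) + j' with
-- i' < h_{R+1} and j' < l_{S+1}. The two sums of the formula count the cells of
-- the rectangles preceding (R , S) in Cantor order: those on the diagonals
-- before R + S, and those before (R , S) on its own diagonal. Once the sign
-- (-1)^t is known, the remaining terms reduce to 1 + l_{S+1} i' + j' or to
-- 1 + h_{R+1} j' + i', the position of the cell inside its rectangle, row by row
-- or column by column. So n = 1 + (cells before the rectangle) + (position in
-- the rectangle), a strictly increasing bijection onto the positive integers.
-- Nothing depends on how t is computed from (R , S), so both choices of t are
-- instances of one argument.
module Submission where

open import Defs
open import Data.Nat using (ℕ; zero; suc; _+_; _*_; _∸_; _≤_; _<_; z≤n; s≤s; _<ᵇ_; _%_; _≤?_)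
open import Data.Nat.Properties
open import Data.Nat.DivMod using (_/_; m≡m%n+[m/n]*n; m%n<n; m<n*o⇒m/o<n)
open import Algebra.Properties.CommutativeSemigroup +-commutativeSemigroup using (interchange)
open import Data.Integer as ℤ using (ℤ; +_; +≤+; +<+; 1ℤ; 0ℤ; -1ℤ; _-_; _^_)
  renaming (_+_ to _⊕_; _*_ to _⊛_)
import Data.Integer.Properties as ℤP
open import Data.Integer.Tactic.RingSolver using (solve-∀)
open import Data.Bool using (true; false; T)
open import Data.Unit using (tt)
open import Data.Product using (_×_; ∃-syntax; _,_)
open import Data.Sum using (_⊎_; inj₁; inj₂)
open import Data.Empty using (⊥-elim)
open import Function using (_∘_)
open import Relation.Nullary using (yes; no)
open import Relation.Binary.Definitions using (tri<; tri≈; tri>)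
open import Relation.Binary.PropositionalEquality

monotone-by-step : ∀ (g : ℕ → ℕ) → (∀ n → g n ≤ g (suc n)) → ∀ {m n} → m ≤ n → g m ≤ g n
monotone-by-step g step {m} {zero}  z≤n = ≤-refl
monotone-by-step g step {m} {suc n} m≤1+n with m ≤? n
... | yes m≤n = ≤-trans (monotone-by-step g step m≤n) (step n)
... | no  m≰n = ≤-reflexive (cong g (≤-antisym m≤1+n (≰⇒> m≰n)))

n≤m⇒m<n+o⇒m∸n<o : ∀ {m n o} → n ≤ m → m < n + o → m ∸ n < o
n≤m⇒m<n+o⇒m∸n<o {m} {n} {o} n≤m m<n+o =
  +-cancelˡ-< n (m ∸ n) o (subst (_< n + o) (sym (m+[n∸m]≡n n≤m)) m<n+o)

crossing-point : ∀ (f : ℕ → ℕ) {x} N → f 0 ≤ x → x < f N →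
  ∃[ k ] (k < N × f k ≤ x × x < f (suc k))
crossing-point f zero    f0≤x x<f0 = ⊥-elim (<⇒≱ x<f0 f0≤x)
crossing-point f {x} (suc N) f0≤x x<f[1+N] with f N ≤? x
... | yes fN≤x = N , ≤-refl , fN≤x , x<f[1+N]
... | no  fN≰x with crossing-point f N f0≤x (≰⇒> fN≰x)
...   | k , k<N , below , above = k , m<n⇒m<1+n k<N , below , above

Σ1-cong : ∀ {f g : ℕ → ℕ} n → (∀ r → 1 ≤ r → r ≤ n → f r ≡ g r) → Σ1 f n ≡ Σ1 g n
Σ1-cong zero    f≗g = refl
Σ1-cong (suc n) f≗g =
  cong₂ _+_ (Σ1-cong n (λ r 1≤r r≤n → f≗g r 1≤r (m≤n⇒m≤1+n r≤n))) (f≗g (suc n) (s≤s z≤n) ≤-refl)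

Σ1-distrib-+ : ∀ (f g : ℕ → ℕ) n → Σ1 (λ r → f r + g r) n ≡ Σ1 f n + Σ1 g n
Σ1-distrib-+ f g zero    = refl
Σ1-distrib-+ f g (suc n) =
  trans (cong (_+ (f (suc n) + g (suc n))) (Σ1-distrib-+ f g n))
        (interchange (Σ1 f n) (Σ1 g n) (f (suc n)) (g (suc n)))

Σ1-mono-≤ : ∀ (f : ℕ → ℕ) {m n} → m ≤ n → Σ1 f m ≤ Σ1 f n
Σ1-mono-≤ f = monotone-by-step (Σ1 f) (λ n → m≤m+n (Σ1 f n) (f (suc n)))

greatest-holds : ∀ P b → greatest P b ≡ 0 ⊎ P (greatest P b) ≡ true
greatest-holds P zero = inj₁ refl
greatest-holds P (suc b) with P (suc b) in holds
... | true  = inj₂ holds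
... | false = greatest-holds P b

greatest-maximal : ∀ P b r → greatest P b < r → r ≤ b → P r ≡ false
greatest-maximal P zero    r g<r z≤n = ⊥-elim (<⇒≱ g<r z≤n)
greatest-maximal P (suc b) r g<r r≤1+b with P (suc b) in fails
... | true  = ⊥-elim (<⇒≱ g<r r≤1+b)
... | false with m≤n⇒m<n∨m≡n r≤1+b
...   | inj₁ r<1+b = greatest-maximal P b r g<r (≤-pred r<1+b)
...   | inj₂ refl  = fails

module Blocks {h : ℕ → ℕ} (h-pos : ∀ m → 1 ≤ m → 1 ≤ h m) where

  r≤Σ1 : ∀ r → r ≤ Σ1 h r
  r≤Σ1 zero    = z≤n
  r≤Σ1 (suc r) = subst (_≤ Σ1 h r + h (suc r)) (+-comm r 1) (+-mono-≤ (r≤Σ1 r) (h-pos (suc r) (s≤s z≤n)))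

  blockIdx-below : ∀ {i} → 1 ≤ i → Σ1 h (blockIdx h i) < i
  blockIdx-below {i} 1≤i with greatest-holds (λ r → Σ1 h r <ᵇ i) i
  ... | inj₁ R≡0  rewrite R≡0 = 1≤i
  ... | inj₂ holds = <ᵇ⇒< _ i (subst T (sym holds) tt)

  blockIdx-above : ∀ i → i ≤ Σ1 h (suc (blockIdx h i))
  blockIdx-above i with suc (blockIdx h i) ≤? i
  ... | yes R<i =
    ≮⇒≥ (λ below → subst T (greatest-maximal (λ r → Σ1 h r <ᵇ i) i _ ≤-refl R<i) (<⇒<ᵇ below))
  ... | no  R≮i = ≤-trans (<⇒≤ (≰⇒> R≮i)) (r≤Σ1 (suc (blockIdx h i)))

  blockIdx-unique : ∀ {i R} → Σ1 h R < i → i ≤ Σ1 h (suc R) → blockIdx h i ≡ R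
  blockIdx-unique {i} {R} below above with <-cmp (blockIdx h i) R
  ... | tri< B<R _ _ = ⊥-elim (<⇒≱ below (≤-trans (blockIdx-above i) (Σ1-mono-≤ h B<R)))
  ... | tri≈ _ B≡R _ = B≡R
  ... | tri> _ _ R<B =
    ⊥-elim (<⇒≱ (blockIdx-below (≤-trans (s≤s z≤n) below)) (≤-trans above (Σ1-mono-≤ h R<B)))

  blockIdx-inBlock : ∀ {R i'} → i' < h (suc R) → blockIdx h (suc (Σ1 h R + i')) ≡ R
  blockIdx-inBlock {R} {i'} i'<h = blockIdx-unique (s≤s (m≤m+n (Σ1 h R) i')) (+-monoʳ-< (Σ1 h R) i'<h)

  data BlockView : ℕ → Set where
    inBlock : ∀ R {i'} → i' < h (suc R) → BlockView (suc (Σ1 h R + i'))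

  blockView : ∀ {i} → 1 ≤ i → BlockView i
  blockView {i} 1≤i =
    subst BlockView (m+[n∸m]≡n below) (inBlock R (n≤m⇒m<n+o⇒m∸n<o below (s≤s (blockIdx-above i))))
    where
    R : ℕ
    R = blockIdx h i
    below : suc (Σ1 h R) ≤ i
    below = blockIdx-below 1≤i

Lex-cancelˡ-+ : ∀ a b {x y x' y'} → Lex (a + x) (b + y) (a + x') (b + y') → Lex x y x' y'
Lex-cancelˡ-+ a b (inj₁ x<x')        = inj₁ (+-cancelˡ-< a _ _ x<x')
Lex-cancelˡ-+ a b (inj₂ (x≡x' , y<y')) = inj₂ (+-cancelˡ-≡ a _ _ x≡x' , +-cancelˡ-< b _ _ y<y')

row-major-<-next-row : ∀ {b x y} → y < b → b * x + y < b * suc x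
row-major-<-next-row {b} {x} {y} y<b =
  subst (b * x + y <_) (trans (+-comm (b * x) b) (sym (*-suc b x))) (+-monoʳ-< (b * x) y<b)

row-major-< : ∀ {a b x y} → x < a → y < b → b * x + y < a * b
row-major-< {a} {b} {x} x<a y<b =
  <-≤-trans (row-major-<-next-row y<b) (subst (b * suc x ≤_) (*-comm b a) (*-monoʳ-≤ b x<a))

row-major-monoLex : ∀ {b x y x' y'} → y < b → Lex x y x' y' → b * x + y < b * x' + y'
row-major-monoLex {b} {x' = x'} y<b (inj₁ x<x') =
  <-≤-trans (row-major-<-next-row y<b) (≤-trans (*-monoʳ-≤ b x<x') (m≤m+n (b * x') _))
row-major-monoLex {b} {x} y<b (inj₂ (refl , y<y')) = +-monoʳ-< (b * x) y<y'

row-major-surjective : ∀ {a b k} → k < a * b → ∃[ x ] ∃[ y ] (x < a × y < b × b * x + y ≡ k)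
row-major-surjective {a} {zero}  {k} k<a*0 = ⊥-elim (<⇒≱ (subst (k <_) (*-zeroʳ a) k<a*0) z≤n)
row-major-surjective {a} {suc b} {k} k<a*b =
  k / suc b , k % suc b , m<n*o⇒m/o<n k<a*b , m%n<n k (suc b) ,
  (begin
    suc b * (k / suc b) + k % suc b ≡⟨ cong (_+ k % suc b) (*-comm (suc b) (k / suc b)) ⟩
    k / suc b * suc b + k % suc b   ≡⟨ +-comm (k / suc b * suc b) (k % suc b) ⟩
    k % suc b + k / suc b * suc b   ≡⟨ m≡m%n+[m/n]*n k (suc b) ⟨
    k                               ∎)
  where open ≡-Reasoning

-1^[2+n]≡-1^n : ∀ n → -1ℤ ^ (2 + n) ≡ -1ℤ ^ n
-1^[2+n]≡-1^n n = trans (ℤP.^-distribˡ-+-* -1ℤ 2 n) (ℤP.*-identityˡ (-1ℤ ^ n))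

data ParityOf (n : ℕ) : Set where
  even : n % 2 ≡ 0 → -1ℤ ^ n ≡ 1ℤ  → ParityOf n
  odd  : n % 2 ≡ 1 → -1ℤ ^ n ≡ -1ℤ → ParityOf n

parityOf : ∀ n → ParityOf n
parityOf 0 = even refl refl
parityOf 1 = odd refl refl
parityOf (suc (suc n)) with parityOf n
... | even n%2≡0 sign = even n%2≡0 (trans (-1^[2+n]≡-1^n n) sign)
... | odd  n%2≡1 sign = odd  n%2≡1 (trans (-1^[2+n]≡-1^n n) sign)

rasterIndex : ∀ {n} → ParityOf n → (rows cols x y : ℕ) → ℕ
rasterIndex (even _ _) rows cols x y = cols * x + y
rasterIndex (odd _ _)  rows cols x y = rows * y + x

rasterIndex-< : ∀ {n} (p : ParityOf n) {rows cols x y} → x < rows → y < cols →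
  rasterIndex p rows cols x y < rows * cols
rasterIndex-< (even _ _) x<rows y<cols = row-major-< x<rows y<cols
rasterIndex-< (odd _ _) {rows} {cols} {x} {y} x<rows y<cols =
  subst (rows * y + x <_) (*-comm cols rows) (row-major-< y<cols x<rows)

rasterIndex-surjective : ∀ {n} (p : ParityOf n) {rows cols k} → k < rows * cols →
  ∃[ x ] ∃[ y ] (x < rows × y < cols × rasterIndex p rows cols x y ≡ k)
rasterIndex-surjective (even _ _) k<area = row-major-surjective k<area
rasterIndex-surjective (odd _ _) {rows} {cols} {k} k<area
  with row-major-surjective (subst (k <_) (*-comm rows cols) k<area)
... | y , x , y<cols , x<rows , index≡k = x , y , x<rows , y<cols , index≡k

rasterIndex-monoLex : ∀ {n} (p : ParityOf n) {rows cols x y x' y'} → x < rows → y < cols →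
  (n % 2 ≡ 0 → Lex x y x' y') → (n % 2 ≡ 1 → Lex y x y' x') →
  rasterIndex p rows cols x y < rasterIndex p rows cols x' y'
rasterIndex-monoLex (even n%2≡0 _) x<rows y<cols row-order col-order = row-major-monoLex y<cols (row-order n%2≡0)
rasterIndex-monoLex (odd n%2≡1 _)  x<rows y<cols row-order col-order = row-major-monoLex x<rows (col-order n%2≡1)

-- The last two terms of the formula at i = 1 + HR + i', j = 1 + LS + j',
-- with A the two sums, once (-1)^t = 1, resp. (-1)^t = -1 below.
row-major-identity : ∀ (A lS hR HR LS i' j' : ℤ) →
  A ⊕ 1ℤ ⊛ (lS ⊛ (1ℤ ⊕ (HR ⊕ i') - HR - 1ℤ) ⊕ (1ℤ ⊕ (LS ⊕ j')) - LS)
    - 0ℤ ⊛ (hR ⊛ (1ℤ ⊕ (LS ⊕ j') - LS - 1ℤ) ⊕ (1ℤ ⊕ (HR ⊕ i')) - HR)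
  ≡ 1ℤ ⊕ (A ⊕ (lS ⊛ i' ⊕ j'))
row-major-identity = solve-∀

column-major-identity : ∀ (A lS hR HR LS i' j' : ℤ) →
  A ⊕ 0ℤ ⊛ (lS ⊛ (1ℤ ⊕ (HR ⊕ i') - HR - 1ℤ) ⊕ (1ℤ ⊕ (LS ⊕ j')) - LS)
    - -1ℤ ⊛ (hR ⊛ (1ℤ ⊕ (LS ⊕ j') - LS - 1ℤ) ⊕ (1ℤ ⊕ (HR ⊕ i')) - HR)
  ≡ 1ℤ ⊕ (A ⊕ (hR ⊛ j' ⊕ i'))
column-major-identity = solve-∀

module Enumeration {h l : ℕ → ℕ} (h-pos : ∀ m → 1 ≤ m → 1 ≤ h m) (l-pos : ∀ m → 1 ≤ m → 1 ≤ l m)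
                   (τ : ℕ → ℕ → ℕ) where

  open Blocks h-pos using () renaming (blockIdx-inBlock to row-inBlock; blockView to rowView; inBlock to rowBlock)
  open Blocks l-pos using () renaming (blockIdx-inBlock to col-inBlock; blockView to colView; inBlock to colBlock)

  area : ℕ → ℕ → ℕ
  area R S = h (suc R) * l (suc S)

  -- The two sums of the formula: diagonalStart d counts the cells of the
  -- rectangles on the diagonals R + S < d (row r of rectangles meets them in its
  -- first d + 1 - r rectangles), and diagonalPrefix d R those of the first R
  -- rectangles of diagonal d.
  diagonalStart : ℕ → ℕ
  diagonalStart d = Σ1 (λ r → h r * Σ1 l (suc d ∸ r)) d

  diagonalPrefix : ℕ → ℕ → ℕ
  diagonalPrefix d R = Σ1 (λ r → h r * l (d + 2 ∸ r)) R

  rectStart : ℕ → ℕ → ℕ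
  rectStart R S = diagonalStart (R + S) + diagonalPrefix (R + S) R

  cellIndex : ℕ → ℕ → ℕ → ℕ → ℕ
  cellIndex R S = rasterIndex (parityOf (τ R S)) (h (suc R)) (l (suc S))

  area-pos : ∀ R S → 1 ≤ area R S
  area-pos R S = *-mono-≤ (h-pos (suc R) (s≤s z≤n)) (l-pos (suc S) (s≤s z≤n))

  diagonalPrefix-suc : ∀ {d R S} → R + S ≡ d → diagonalPrefix d (suc R) ≡ diagonalPrefix d R + area R S
  diagonalPrefix-suc {R = R} {S} refl = cong (λ c → diagonalPrefix (R + S) R + h (suc R) * l c) column
    where
    column : R + S + 2 ∸ suc R ≡ suc S
    column = trans (cong (_∸ suc R) R+S+2≡[1+R]+[1+S]) (m+n∸m≡n (suc R) (suc S))
      where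
      R+S+2≡[1+R]+[1+S] : R + S + 2 ≡ suc R + suc S
      R+S+2≡[1+R]+[1+S] = trans (+-assoc R S 2) (trans (cong (_+_ R) (+-comm S 2)) (+-suc R (suc S)))

  diagonalStart-suc : ∀ d → diagonalStart (suc d) ≡ diagonalStart d + diagonalPrefix d (suc d)
  diagonalStart-suc d = begin
      diagonalStart (suc d)
    ≡⟨ Σ1-cong (suc d) split-row ⟩
      Σ1 (λ r → h r * Σ1 l (suc d ∸ r) + h r * l (d + 2 ∸ r)) (suc d)
    ≡⟨ Σ1-distrib-+ _ _ (suc d) ⟩
      (diagonalStart d + h (suc d) * Σ1 l (d ∸ d)) + diagonalPrefix d (suc d)
    ≡⟨ cong (_+ diagonalPrefix d (suc d)) last-row-empty ⟩
      diagonalStart d + diagonalPrefix d (suc d)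
    ∎
    where
    open ≡-Reasoning
    split-row : ∀ r → 1 ≤ r → r ≤ suc d →
      h r * Σ1 l (suc (suc d) ∸ r) ≡ h r * Σ1 l (suc d ∸ r) + h r * l (d + 2 ∸ r)
    split-row r _ r≤1+d rewrite +-comm d 2 | +-∸-assoc 1 r≤1+d = *-distribˡ-+ (h r) _ _
    last-row-empty : diagonalStart d + h (suc d) * Σ1 l (d ∸ d) ≡ diagonalStart d
    last-row-empty rewrite n∸n≡0 d | *-zeroʳ (h (suc d)) = +-identityʳ (diagonalStart d)

  diagonalStart-mono-≤ : ∀ {d d'} → d ≤ d' → diagonalStart d ≤ diagonalStart d'
  diagonalStart-mono-≤ = monotone-by-step diagonalStart
    (λ d → subst (diagonalStart d ≤_) (sym (diagonalStart-suc d)) (m≤m+n _ _))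

  d≤diagonalStart : ∀ d → d ≤ diagonalStart d
  d≤diagonalStart zero    = z≤n
  d≤diagonalStart (suc d) = subst (suc d ≤_) (sym (diagonalStart-suc d))
    (subst (_≤ diagonalStart d + diagonalPrefix d (suc d)) (+-comm d 1)
           (+-mono-≤ (d≤diagonalStart d) last-nonempty))
    where
    last-nonempty : 1 ≤ diagonalPrefix d (suc d)
    last-nonempty = subst (1 ≤_) (sym (diagonalPrefix-suc (+-identityʳ d)))
                          (≤-trans (area-pos d 0) (m≤n+m _ _))

  rectStart+area : ∀ R S → rectStart R S + area R S ≡ diagonalStart (R + S) + diagonalPrefix (R + S) (suc R)
  rectStart+area R S = trans (+-assoc (diagonalStart (R + S)) _ _)
    (cong (_+_ (diagonalStart (R + S))) (sym (diagonalPrefix-suc refl)))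

  rectStart-next : ∀ {R S R' S'} → Lex (R + S) R (R' + S') R' → rectStart R S + area R S ≤ rectStart R' S'
  rectStart-next {R} {S} {R'} {S'} (inj₁ d<d') = begin
    rectStart R S + area R S                   ≡⟨ rectStart+area R S ⟩
    diagonalStart d + diagonalPrefix d (suc R) ≤⟨ +-monoʳ-≤ (diagonalStart d) (Σ1-mono-≤ _ (s≤s (m≤m+n R S))) ⟩
    diagonalStart d + diagonalPrefix d (suc d) ≡⟨ diagonalStart-suc d ⟨
    diagonalStart (suc d)                      ≤⟨ diagonalStart-mono-≤ d<d' ⟩
    diagonalStart (R' + S')                    ≤⟨ m≤m+n _ _ ⟩
    rectStart R' S'                            ∎
    where
    open ≤-Reasoning
    d : ℕ
    d = R + S
  rectStart-next {R} {S} {R'} {S'} (inj₂ (d≡d' , R<R')) = begin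
    rectStart R S + area R S                   ≡⟨ rectStart+area R S ⟩
    diagonalStart d + diagonalPrefix d (suc R) ≤⟨ +-monoʳ-≤ (diagonalStart d) (Σ1-mono-≤ _ R<R') ⟩
    diagonalStart d + diagonalPrefix d R'      ≡⟨ cong (λ e → diagonalStart e + diagonalPrefix e R') d≡d' ⟩
    rectStart R' S'                            ∎
    where
    open ≤-Reasoning
    d : ℕ
    d = R + S

  rectStart-cover : ∀ m → ∃[ R ] ∃[ S ] ∃[ k ] (k < area R S × rectStart R S + k ≡ m)
  rectStart-cover m
    with crossing-point diagonalStart (suc m) z≤n (<-≤-trans (n<1+n m) (d≤diagonalStart (suc m)))
  ... | d , _ , start≤m , m<next
    with crossing-point (diagonalPrefix d) (suc d) z≤n
           (n≤m⇒m<n+o⇒m∸n<o start≤m (subst (m <_) (diagonalStart-suc d) m<next))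
  ... | R , R<1+d , prefix≤ , <prefix = R , S , k , k<area , start+k≡m
    where
    open ≡-Reasoning
    S k : ℕ
    S = d ∸ R
    k = m ∸ diagonalStart d ∸ diagonalPrefix d R
    R+S≡d : R + S ≡ d
    R+S≡d = m+[n∸m]≡n (≤-pred R<1+d)
    k<area : k < area R S
    k<area = n≤m⇒m<n+o⇒m∸n<o prefix≤ (subst (m ∸ diagonalStart d <_) (diagonalPrefix-suc R+S≡d) <prefix)
    start+k≡m : rectStart R S + k ≡ m
    start+k≡m = begin
      rectStart R S + k                                ≡⟨ cong (λ e → diagonalStart e + diagonalPrefix e R + k) R+S≡d ⟩
      diagonalStart d + diagonalPrefix d R + k         ≡⟨ +-assoc (diagonalStart d) _ _ ⟩
      diagonalStart d + (diagonalPrefix d R + k)       ≡⟨ cong (_+_ (diagonalStart d)) (m+[n∸m]≡n prefix≤) ⟩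
      diagonalStart d + (m ∸ diagonalStart d)          ≡⟨ m+[n∸m]≡n start≤m ⟩
      m                                                ∎

  formula-inBlock : ∀ {R S i' j'} → i' < h (suc R) → j' < l (suc S) →
    formula τ h l (suc (Σ1 h R + i')) (suc (Σ1 l S + j')) ≡ + suc (rectStart R S + cellIndex R S i' j')
  formula-inBlock {R} {S} {i'} {j'} i'<h j'<l rewrite row-inBlock i'<h | col-inBlock j'<l
    with parityOf (τ R S)
  ... | even _ sign rewrite sign =
    trans (row-major-identity (+ rectStart R S) (+ l (suc S)) (+ h (suc R)) (+ Σ1 h R) (+ Σ1 l S) (+ i') (+ j'))
          (cong (λ x → 1ℤ ⊕ (+ rectStart R S ⊕ (x ⊕ + j'))) (sym (ℤP.pos-* (l (suc S)) i')))
  ... | odd _ sign rewrite sign =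
    trans (column-major-identity (+ rectStart R S) (+ l (suc S)) (+ h (suc R)) (+ Σ1 h R) (+ Σ1 l S) (+ i') (+ j'))
          (cong (λ x → 1ℤ ⊕ (+ rectStart R S ⊕ (x ⊕ + i'))) (sym (ℤP.pos-* (h (suc R)) j')))

  formula-positive : ∀ i j → 1 ≤ i → 1 ≤ j → 1ℤ ℤ.≤ formula τ h l i j
  formula-positive i j 1≤i 1≤j with rowView 1≤i | colView 1≤j
  ... | rowBlock R i'<h | colBlock S j'<l =
    subst (1ℤ ℤ.≤_) (sym (formula-inBlock i'<h j'<l)) (+≤+ (s≤s z≤n))

  formula-attains : ∀ {R S k} → k < area R S →
    ∃[ i ] ∃[ j ] (1 ≤ i × 1 ≤ j × formula τ h l i j ≡ + suc (rectStart R S + k))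
  formula-attains {R} {S} k<area with rasterIndex-surjective (parityOf (τ R S)) {h (suc R)} {l (suc S)} k<area
  ... | i' , j' , i'<h , j'<l , refl =
    suc (Σ1 h R + i') , suc (Σ1 l S + j') , s≤s z≤n , s≤s z≤n , formula-inBlock i'<h j'<l

  formula-surjective : ∀ n → 1 ≤ n → ∃[ i ] ∃[ j ] (1 ≤ i × 1 ≤ j × formula τ h l i j ≡ + n)
  formula-surjective (suc m) _ =
    let R , S , k , k<area , start+k≡m = rectStart-cover m
    in subst (λ n → ∃[ i ] ∃[ j ] (1 ≤ i × 1 ≤ j × formula τ h l i j ≡ + suc n))
             start+k≡m (formula-attains k<area)

  cells-ordered : ∀ {R S R₂ S₂ i' j' i₂' j₂'} →
    i' < h (suc R) → j' < l (suc S) → i₂' < h (suc R₂) → j₂' < l (suc S₂) →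
    Before τ h l (suc (Σ1 h R + i') , suc (Σ1 l S + j')) (suc (Σ1 h R₂ + i₂') , suc (Σ1 l S₂ + j₂')) →
    rectStart R S + cellIndex R S i' j' < rectStart R₂ S₂ + cellIndex R₂ S₂ i₂' j₂'
  cells-ordered {R} {S} {R₂} {S₂} {i'} {j'} {i₂'} {j₂'} i'<h j'<l i₂'<h j₂'<l before
    rewrite row-inBlock i'<h | col-inBlock j'<l | row-inBlock i₂'<h | col-inBlock j₂'<l
    with before
  ... | inj₁ diagonal-order = begin-strict
    rectStart R S + cellIndex R S i' j'     <⟨ +-monoʳ-< (rectStart R S) (rasterIndex-< (parityOf (τ R S)) i'<h j'<l) ⟩
    rectStart R S + area R S                ≤⟨ rectStart-next diagonal-order ⟩
    rectStart R₂ S₂                         ≤⟨ m≤m+n _ _ ⟩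
    rectStart R₂ S₂ + cellIndex R₂ S₂ i₂' j₂' ∎
    where open ≤-Reasoning
  ... | inj₂ (refl , refl , row-order , column-order) = +-monoʳ-< (rectStart R S)
    (rasterIndex-monoLex (parityOf (τ R S)) i'<h j'<l
      (Lex-cancelˡ-+ (suc (Σ1 h R)) (suc (Σ1 l S)) ∘ row-order)
      (Lex-cancelˡ-+ (suc (Σ1 l S)) (suc (Σ1 h R)) ∘ column-order))

  formula-monotone : ∀ i j i₂ j₂ → 1 ≤ i → 1 ≤ j → 1 ≤ i₂ → 1 ≤ j₂ →
    Before τ h l (i , j) (i₂ , j₂) → formula τ h l i j ℤ.< formula τ h l i₂ j₂
  formula-monotone i j i₂ j₂ 1≤i 1≤j 1≤i₂ 1≤j₂ before
    with rowView 1≤i | colView 1≤j | rowView 1≤i₂ | colView 1≤j₂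
  ... | rowBlock R i'<h | colBlock S j'<l | rowBlock R₂ i₂'<h | colBlock S₂ j₂'<l =
    subst₂ ℤ._<_ (sym (formula-inBlock i'<h j'<l)) (sym (formula-inBlock i₂'<h j₂'<l))
      (+<+ (s≤s (cells-ordered i'<h j'<l i₂'<h j₂'<l before)))

  formula-isNumeration : IsNumeration (Before τ h l) (formula τ h l)
  formula-isNumeration = formula-positive , formula-surjective , formula-monotone

mainTheorem1 : (h l : ℕ → ℕ) →
    (∀ m → 1 ≤ m → 1 ≤ h m) → (∀ m → 1 ≤ m → 1 ≤ l m) →
    IsNumeration (Before cantorT h l) (formula cantorT h l)
    × IsNumeration (Before diagT h l) (formula diagT h l)
mainTheorem1 h l h-pos l-pos =
  Enumeration.formula-isNumeration h-pos l-pos cantorT , Enumeration.formula-isNumeration h-pos l-pos diagT
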